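{- For every positive integer $n$, \[ \sum_{k=1}^{n}\frac{\binom{n}{k}}{1+2k}=\frac{4^n}{(1+2n)\binom{2n}{n}}\sum_{k=1}^{n}\frac{\binom{2k}{k}}{2^k}+\frac{4^n}{(1+2n)\binom{2n}{n}}-1, \] and \[ \sum_{k=1}^{n}\frac{\binom{n}{k}}{k}=-\sum_{k=1}^{n}\frac{1}{k}+\sum_{k=1}^{n}\frac{2^k}{k}. \] -}

module Defs where

open import Data.Nat using (ℕ; zero; suc)
open import Data.Rational using (ℚ; 0ℚ; normalize)
import Data.Rational as ℚ

sum1to : ℕ → (ℕ → ℚ) → ℚ
sum1to zero    f = 0ℚ
sum1to (suc n) f = sum1to n f ℚ.+ f (suc n)

-- a / d as a rational number, for naturals a, d.  Convention a / 0 = 0;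
-- this case never arises in the statement (all denominators are ≥ 1).
_÷ℕ_ : ℕ → ℕ → ℚ
a ÷ℕ zero    = 0ℚ
a ÷ℕ (suc d) = normalize a (suc d)

infixl 7 _÷ℕ_

-- Write T n = Σ_{k=1}^n C(n,k)/(2k+1) and A n = 4^n / ((2n+1) C(2n,n)).  Pascal's rule and
-- (n+1) C(n+1,k) = k C(n+1,k) + (n+1) C(n,k) turn (2n+3) T (n+1) into a sum of the row
-- Σ_{k≥1} C(n+1,k) = 2^(n+1) - 1 and (2n+2) T n, so T' := T + 1 satisfies
-- (2n+3) T' (n+1) = (2n+2) T' n + 2^(n+1).  From (n+1) C(2n+2,n+1) = 2 (2n+1) C(2n,n) one gets
-- (2n+3) A (n+1) = (2n+2) A n and (2n+3) A (n+1) C(2n+2,n+1)/2^(n+1) = 2^(n+1), so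
-- A n (1 + Σ_{k=1}^n C(2k,k)/2^k) satisfies the same recurrence and the same initial value 1.
-- For the second identity, absorption k C(n+1,k) = (n+1) C(n,k-1) gives the increment
-- Σ_{k=1}^{n+1} C(n+1,k)/k - Σ_{k=1}^n C(n,k)/k = (2^(n+1) - 1)/(n+1).

module Submission where

open import Data.Nat using (ℕ; zero; suc; pred; NonZero; _≤_)
import Data.Nat as N
import Data.Nat.Properties as NP
open import Data.Nat.Combinatorics using (_C_; k>n⇒nCk≡0)
open import Data.Nat.Coprimality using (1-coprimeTo) renaming (sym to coprime-sym)
open import Relation.Binary.PropositionalEquality
open ≡-Reasoning

module Binomial where
  open import Data.Nat using (_+_; _*_; _∸_; _<_; z≤n; s≤s)
  open import Data.Nat.Combinatorics using (nCk+nC[k+1]≡[n+1]C[k+1]; nC1≡n; nCk≡nC[n∸k])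
  open import Data.Nat.Tactic.RingSolver using (solve-∀)
  open import Algebra.Properties.CommutativeSemigroup NP.*-commutativeSemigroup using (x∙yz≈y∙xz)

  [1+n]C[1+k]≡nC[1+k]+nCk : ∀ n k → suc n C suc k ≡ n C suc k + n C k
  [1+n]C[1+k]≡nC[1+k]+nCk n k = trans (sym (nCk+nC[k+1]≡[n+1]C[k+1] n k)) (NP.+-comm (n C k) (n C suc k))

  k≤n⇒nCk>0 : ∀ {n k} → k ≤ n → 0 < n C k
  k≤n⇒nCk>0 {n}     {zero}  _         = s≤s z≤n
  k≤n⇒nCk>0 {suc n} {suc k} (s≤s k≤n) = subst (0 <_) (nCk+nC[k+1]≡[n+1]C[k+1] n k)
    (NP.<-≤-trans (k≤n⇒nCk>0 k≤n) (NP.m≤m+n (n C k) (n C suc k)))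

  [1+k]*[1+n]C[1+k]≡[1+n]*nCk : ∀ n k → suc k * (suc n C suc k) ≡ suc n * (n C k)
  [1+k]*[1+n]C[1+k]≡[1+n]*nCk zero    zero    = refl
  [1+k]*[1+n]C[1+k]≡[1+n]*nCk zero    (suc k) = NP.*-zeroʳ (2 + k)
  [1+k]*[1+n]C[1+k]≡[1+n]*nCk (suc n) zero    =
    trans (NP.*-identityˡ _) (trans (nC1≡n (2 + n)) (sym (NP.*-identityʳ (2 + n))))
  [1+k]*[1+n]C[1+k]≡[1+n]*nCk (suc n) (suc k) = begin
    (2 + k) * ((2 + n) C (2 + k))              ≡⟨ cong ((2 + k) *_) ([1+n]C[1+k]≡nC[1+k]+nCk (suc n) (suc k)) ⟩
    (2 + k) * (b + a)                           ≡⟨ split k a b ⟩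
    a + (1 + k) * a + (2 + k) * b               ≡⟨ cong₂ (λ x y → a + x + y) ([1+k]*[1+n]C[1+k]≡[1+n]*nCk n k)
                                                                           ([1+k]*[1+n]C[1+k]≡[1+n]*nCk n (suc k)) ⟩
    a + (1 + n) * (n C k) + (1 + n) * (n C suc k) ≡⟨ merge n a (n C k) (n C suc k) ⟩
    a + (1 + n) * (n C suc k + n C k)           ≡⟨ cong (λ x → a + (1 + n) * x) ([1+n]C[1+k]≡nC[1+k]+nCk n k) ⟨
    a + (1 + n) * a                             ≡⟨ collect n a ⟩
    (2 + n) * a                                 ∎
    where
    a = suc n C suc k
    b = suc n C (2 + k)
    split : ∀ k a b → (2 + k) * (b + a) ≡ a + (1 + k) * a + (2 + k) * b
    split = solve-∀
    merge : ∀ n a c d → a + (1 + n) * c + (1 + n) * d ≡ a + (1 + n) * (d + c)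
    merge = solve-∀
    collect : ∀ n a → a + (1 + n) * a ≡ (2 + n) * a
    collect = solve-∀

  [1+n]*[1+n]Ck≡k*[1+n]Ck+[1+n]*nCk : ∀ n k → suc n * (suc n C k) ≡ k * (suc n C k) + suc n * (n C k)
  [1+n]*[1+n]Ck≡k*[1+n]Ck+[1+n]*nCk n zero    = refl
  [1+n]*[1+n]Ck≡k*[1+n]Ck+[1+n]*nCk n (suc k) = begin
    suc n * (suc n C suc k)                   ≡⟨ cong (suc n *_) ([1+n]C[1+k]≡nC[1+k]+nCk n k) ⟩
    suc n * (n C suc k + n C k)               ≡⟨ NP.*-distribˡ-+ (suc n) (n C suc k) (n C k) ⟩
    suc n * (n C suc k) + suc n * (n C k)     ≡⟨ cong (suc n * (n C suc k) +_) ([1+k]*[1+n]C[1+k]≡[1+n]*nCk n k) ⟨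
    suc n * (n C suc k) + suc k * (suc n C suc k) ≡⟨ NP.+-comm (suc n * (n C suc k)) (suc k * (suc n C suc k)) ⟩
    suc k * (suc n C suc k) + suc n * (n C suc k) ∎

  [1+n]Ck*[1+2[1+n]]≡[1+n]Ck*[1+2k]+nCk*2[1+n] : ∀ n k →
    (suc n C k) * (1 + 2 * suc n) ≡ (suc n C k) * (1 + 2 * k) + (n C k) * (2 * suc n)
  [1+n]Ck*[1+2[1+n]]≡[1+n]Ck*[1+2k]+nCk*2[1+n] n k = begin
    x * (1 + 2 * suc n)               ≡⟨ expand n x ⟩
    x + 2 * (suc n * x)               ≡⟨ cong (λ z → x + 2 * z) ([1+n]*[1+n]Ck≡k*[1+n]Ck+[1+n]*nCk n k) ⟩
    x + 2 * (k * x + suc n * y)       ≡⟨ collect n k x y ⟩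
    x * (1 + 2 * k) + y * (2 * suc n) ∎
    where
    x = suc n C k
    y = n C k
    expand : ∀ n x → x * (1 + 2 * suc n) ≡ x + 2 * (suc n * x)
    expand = solve-∀
    collect : ∀ n k x y → x + 2 * (k * x + suc n * y) ≡ x * (1 + 2 * k) + y * (2 * suc n)
    collect = solve-∀

  [1+2n]Cn≡[1+2n]C[1+n] : ∀ n → suc (2 * n) C n ≡ suc (2 * n) C suc n
  [1+2n]Cn≡[1+2n]C[1+n] n = trans (nCk≡nC[n∸k] n≤1+2n) (cong (suc (2 * n) C_) 1+2n∸n≡1+n)
    where
    n≤2n : n ≤ 2 * n
    n≤2n = NP.m≤m+n n (n + 0)
    n≤1+2n : n ≤ suc (2 * n)
    n≤1+2n = NP.m≤n⇒m≤1+n n≤2n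
    1+2n∸n≡1+n : suc (2 * n) ∸ n ≡ suc n
    1+2n∸n≡1+n = trans (NP.+-∸-assoc 1 n≤2n) (cong suc (trans (NP.m+n∸m≡n n (n + 0)) (NP.+-identityʳ n)))

  [1+n]*C[2+2n,1+n]≡2*[1+2n]*C[2n,n] : ∀ n → suc n * ((2 * suc n) C suc n) ≡ 2 * ((1 + 2 * n) * ((2 * n) C n))
  [1+n]*C[2+2n,1+n]≡2*[1+2n]*C[2n,n] n = NP.*-cancelˡ-≡ _ _ (suc n) (begin
    suc n * (suc n * ((2 * suc n) C suc n))   ≡⟨ cong (λ x → suc n * (suc n * (x C suc n))) (NP.*-suc 2 n) ⟩
    suc n * (suc n * ((2 + m) C suc n))       ≡⟨ cong (suc n *_) ([1+k]*[1+n]C[1+k]≡[1+n]*nCk (suc m) n) ⟩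
    suc n * ((2 + m) * (suc m C n))           ≡⟨ x∙yz≈y∙xz (suc n) (2 + m) (suc m C n) ⟩
    (2 + m) * (suc n * (suc m C n))           ≡⟨ cong (λ x → (2 + m) * (suc n * x)) ([1+2n]Cn≡[1+2n]C[1+n] n) ⟩
    (2 + m) * (suc n * (suc m C suc n))       ≡⟨ cong ((2 + m) *_) ([1+k]*[1+n]C[1+k]≡[1+n]*nCk m n) ⟩
    (2 + m) * ((1 + m) * (m C n))             ≡⟨ regroup n ((1 + m) * (m C n)) ⟩
    suc n * (2 * ((1 + m) * (m C n)))         ∎)
    where
    m = 2 * n
    regroup : ∀ n y → (2 + 2 * n) * y ≡ (1 + n) * (2 * y)
    regroup = solve-∀

open import Data.Rational using (ℚ; mkℚ; 0ℚ; 1ℚ; _+_; _*_; _-_; -_; 1/_)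
import Data.Rational.Properties as QP
import Data.Rational.Unnormalised as U
import Data.Rational.Unnormalised.Properties as UP
open import Data.Rational.Solver using (module +-*-Solver)
open import Data.Product using (_×_; _,_)
open import Algebra.Bundles using (CommutativeMonoid)
open import Algebra.Properties.CommutativeSemigroup (CommutativeMonoid.commutativeSemigroup QP.+-0-commutativeMonoid)
  using () renaming (interchange to +-interchange)

open Binomial
open import Defs

module Embedding where
  open import Data.Integer using (+_)
  import Data.Integer as Z
  import Data.Integer.Properties as ZP

  fromℕ : ℕ → ℚ
  fromℕ n = mkℚ (+ n) 0 (coprime-sym (1-coprimeTo n))

  fromℕ-homo-+ : ∀ a b → fromℕ (a N.+ b) ≡ fromℕ a + fromℕ b
  fromℕ-homo-+ a b = QP.toℚᵘ-injective
    (UP.≃-trans (U.*≡* integer-identity) (UP.≃-sym (QP.toℚᵘ-homo-+ (fromℕ a) (fromℕ b))))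
    where
    integer-identity : + (a N.+ b) Z.* + 1 ≡ (+ a Z.* + 1 Z.+ + b Z.* + 1) Z.* + 1
    integer-identity rewrite ZP.*-identityʳ (+ (a N.+ b)) | ZP.*-identityʳ (+ a)
      | ZP.*-identityʳ (+ b) | ZP.*-identityʳ (+ a Z.+ + b) = ZP.pos-+ a b

  fromℕ-homo-* : ∀ a b → fromℕ (a N.* b) ≡ fromℕ a * fromℕ b
  fromℕ-homo-* a b = QP.toℚᵘ-injective
    (UP.≃-trans (U.*≡* (cong (Z._* + 1) (ZP.pos-* a b))) (UP.≃-sym (QP.toℚᵘ-homo-* (fromℕ a) (fromℕ b))))

  ÷ℕ-*-cancel : ∀ a d .{{_ : NonZero d}} → (a ÷ℕ d) * fromℕ d ≡ fromℕ a
  ÷ℕ-*-cancel a (suc d) = QP.toℚᵘ-injective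
    (UP.≃-trans (QP.toℚᵘ-homo-* (a ÷ℕ suc d) (fromℕ (suc d)))
      (UP.≃-trans (UP.*-congʳ (QP.toℚᵘ-fromℚᵘ (U.mkℚᵘ (+ a) d))) (U.*≡* integer-identity)))
    where
    integer-identity : (+ a Z.* + suc d) Z.* + 1 ≡ + a Z.* + suc (d N.* 1)
    integer-identity rewrite NP.*-identityʳ d | ZP.*-identityʳ (+ a Z.* + suc d) = refl

open Embedding

*-cancelʳ-fromℕ : ∀ d .{{_ : NonZero d}} {x y : ℚ} → x * fromℕ d ≡ y * fromℕ d → x ≡ y
*-cancelʳ-fromℕ (suc d) {x} {y} xd≡yd = begin
  x                  ≡⟨ undo x ⟨
  x * δ * 1/ δ       ≡⟨ cong (_* 1/ δ) xd≡yd ⟩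
  y * δ * 1/ δ       ≡⟨ undo y ⟩
  y                  ∎
  where
  δ = fromℕ (suc d)
  undo : ∀ z → z * δ * 1/ δ ≡ z
  undo z = trans (QP.*-assoc z δ (1/ δ)) (trans (cong (z *_) (QP.*-inverseʳ δ)) (QP.*-identityʳ z))

÷ℕ-unique : ∀ {x} a d .{{_ : NonZero d}} → x * fromℕ d ≡ fromℕ a → x ≡ a ÷ℕ d
÷ℕ-unique a d xd≡a = *-cancelʳ-fromℕ d (trans xd≡a (sym (÷ℕ-*-cancel a d)))

0÷ℕ : ∀ d → 0 ÷ℕ d ≡ 0ℚ
0÷ℕ zero    = refl
0÷ℕ (suc d) = sym (÷ℕ-unique 0 (suc d) (QP.*-zeroˡ (fromℕ (suc d))))

*÷ℕ-cancel : ∀ a d .{{_ : NonZero d}} → (a N.* d) ÷ℕ d ≡ fromℕ a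
*÷ℕ-cancel a d = sym (÷ℕ-unique (a N.* d) d (sym (fromℕ-homo-* a d)))

÷ℕ-distribʳ-+ : ∀ a b d .{{_ : NonZero d}} → (a N.+ b) ÷ℕ d ≡ a ÷ℕ d + b ÷ℕ d
÷ℕ-distribʳ-+ a b d = sym (÷ℕ-unique (a N.+ b) d (begin
  (a ÷ℕ d + b ÷ℕ d) * fromℕ d                     ≡⟨ QP.*-distribʳ-+ (fromℕ d) (a ÷ℕ d) (b ÷ℕ d) ⟩
  (a ÷ℕ d) * fromℕ d + (b ÷ℕ d) * fromℕ d         ≡⟨ cong₂ _+_ (÷ℕ-*-cancel a d) (÷ℕ-*-cancel b d) ⟩
  fromℕ a + fromℕ b                               ≡⟨ fromℕ-homo-+ a b ⟨
  fromℕ (a N.+ b)                                 ∎))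

÷ℕ-*-fromℕ : ∀ a e d .{{_ : NonZero d}} → (a ÷ℕ d) * fromℕ e ≡ (a N.* e) ÷ℕ d
÷ℕ-*-fromℕ a e d = ÷ℕ-unique (a N.* e) d (begin
  (a ÷ℕ d) * fromℕ e * fromℕ d   ≡⟨ QP.*-assoc (a ÷ℕ d) (fromℕ e) (fromℕ d) ⟩
  (a ÷ℕ d) * (fromℕ e * fromℕ d) ≡⟨ cong ((a ÷ℕ d) *_) (QP.*-comm (fromℕ e) (fromℕ d)) ⟩
  (a ÷ℕ d) * (fromℕ d * fromℕ e) ≡⟨ QP.*-assoc (a ÷ℕ d) (fromℕ d) (fromℕ e) ⟨
  (a ÷ℕ d) * fromℕ d * fromℕ e   ≡⟨ cong (_* fromℕ e) (÷ℕ-*-cancel a d) ⟩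
  fromℕ a * fromℕ e              ≡⟨ fromℕ-homo-* a e ⟨
  fromℕ (a N.* e)                ∎)

÷ℕ-*-÷ℕ : ∀ a b c .{{_ : NonZero b}} .{{_ : NonZero c}} → (a ÷ℕ b) * (b ÷ℕ c) ≡ a ÷ℕ c
÷ℕ-*-÷ℕ a b c = ÷ℕ-unique a c (begin
  (a ÷ℕ b) * (b ÷ℕ c) * fromℕ c   ≡⟨ QP.*-assoc (a ÷ℕ b) (b ÷ℕ c) (fromℕ c) ⟩
  (a ÷ℕ b) * ((b ÷ℕ c) * fromℕ c) ≡⟨ cong ((a ÷ℕ b) *_) (÷ℕ-*-cancel b c) ⟩
  (a ÷ℕ b) * fromℕ b              ≡⟨ ÷ℕ-*-cancel a b ⟩
  fromℕ a                         ∎)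

sum1to-cong : ∀ n {f g : ℕ → ℚ} → (∀ k → f (suc k) ≡ g (suc k)) → sum1to n f ≡ sum1to n g
sum1to-cong zero    f≗g = refl
sum1to-cong (suc n) f≗g = cong₂ _+_ (sum1to-cong n f≗g) (f≗g n)

sum1to-distrib-+ : ∀ n (f g : ℕ → ℚ) → sum1to n (λ k → f k + g k) ≡ sum1to n f + sum1to n g
sum1to-distrib-+ zero    f g = refl
sum1to-distrib-+ (suc n) f g = trans (cong (_+ (f (suc n) + g (suc n))) (sum1to-distrib-+ n f g))
  (+-interchange (sum1to n f) (sum1to n g) (f (suc n)) (g (suc n)))

sum1to-distribʳ-* : ∀ n (f : ℕ → ℚ) c → sum1to n (λ k → f k * c) ≡ sum1to n f * c
sum1to-distribʳ-* zero    f c = sym (QP.*-zeroˡ c)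
sum1to-distribʳ-* (suc n) f c = trans (cong (_+ f (suc n) * c) (sum1to-distribʳ-* n f c))
  (sym (QP.*-distribʳ-+ c (sum1to n f) (f (suc n))))

sum1to-shift : ∀ n (f : ℕ → ℚ) → sum1to (suc n) f ≡ f 1 + sum1to n (λ k → f (suc k))
sum1to-shift zero    f = QP.+-comm 0ℚ (f 1)
sum1to-shift (suc n) f = trans (cong (_+ f (2 N.+ n)) (sum1to-shift n f))
  (QP.+-assoc (f 1) (sum1to n (λ k → f (suc k))) (f (2 N.+ n)))

sum1to-extend : ∀ n (f : ℕ → ℚ) → f (suc n) ≡ 0ℚ → sum1to (suc n) f ≡ sum1to n f
sum1to-extend n f fn+1≡0 = trans (cong (sum1to n f +_) fn+1≡0) (QP.+-identityʳ (sum1to n f))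

binomial-sum : ∀ m → 1ℚ + sum1to m (λ k → fromℕ (m C k)) ≡ fromℕ (2 N.^ m)
binomial-sum zero    = refl
binomial-sum (suc m) = begin
  1ℚ + sum1to (suc m) (λ k → fromℕ (suc m C k))                    ≡⟨ cong (1ℚ +_) (sum1to-cong (suc m) pascal) ⟩
  1ℚ + sum1to (suc m) (λ k → fromℕ (m C k) + fromℕ (m C pred k))   ≡⟨ cong (1ℚ +_) (sum1to-distrib-+ (suc m) _ _) ⟩
  1ℚ + (sum1to (suc m) (λ k → fromℕ (m C k))
        + sum1to (suc m) (λ k → fromℕ (m C pred k)))               ≡⟨ cong₂ (λ x y → 1ℚ + (x + y)) (sum1to-extend m _ mC[1+m]≡0)
                                                                                                    (sum1to-shift m _) ⟩
  1ℚ + (B + (1ℚ + B))                                              ≡⟨ regroup B ⟩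
  (1ℚ + B) + (1ℚ + B)                                              ≡⟨ cong₂ _+_ (binomial-sum m) (binomial-sum m) ⟩
  fromℕ (2 N.^ m) + fromℕ (2 N.^ m)                                ≡⟨ fromℕ-homo-+ (2 N.^ m) (2 N.^ m) ⟨
  fromℕ (2 N.^ m N.+ 2 N.^ m)                                      ≡⟨ cong (λ x → fromℕ (2 N.^ m N.+ x)) (NP.+-identityʳ (2 N.^ m)) ⟨
  fromℕ (2 N.^ suc m)                                              ∎
  where
  open +-*-Solver
  B = sum1to m (λ k → fromℕ (m C k))
  pascal : ∀ k → fromℕ (suc m C suc k) ≡ fromℕ (m C suc k) + fromℕ (m C k)
  pascal k = trans (cong fromℕ ([1+n]C[1+k]≡nC[1+k]+nCk m k)) (fromℕ-homo-+ (m C suc k) (m C k))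
  mC[1+m]≡0 : fromℕ (m C suc m) ≡ 0ℚ
  mC[1+m]≡0 = cong fromℕ (k>n⇒nCk≡0 (NP.n<1+n m))
  regroup : ∀ b → 1ℚ + (b + (1ℚ + b)) ≡ (1ℚ + b) + (1ℚ + b)
  regroup = solve 1 (λ b → con 1ℚ :+ (b :+ (con 1ℚ :+ b)) := (con 1ℚ :+ b) :+ (con 1ℚ :+ b)) refl

nC[1+n]÷ℕd≡0 : ∀ n d → (n C suc n) ÷ℕ d ≡ 0ℚ
nC[1+n]÷ℕd≡0 n d = trans (cong (_÷ℕ d) (k>n⇒nCk≡0 (NP.n<1+n n))) (0÷ℕ d)

sum-nC[k-1]/k : ∀ n → sum1to (suc n) (λ k → (n C pred k) ÷ℕ k) + 1 ÷ℕ suc n ≡ (2 N.^ suc n) ÷ℕ suc n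
sum-nC[k-1]/k n = ÷ℕ-unique (2 N.^ suc n) (suc n) (begin
  (G + 1 ÷ℕ suc n) * fromℕ (suc n)                        ≡⟨ QP.*-distribʳ-+ (fromℕ (suc n)) G (1 ÷ℕ suc n) ⟩
  G * fromℕ (suc n) + (1 ÷ℕ suc n) * fromℕ (suc n)        ≡⟨ cong₂ _+_ (sym (sum1to-distribʳ-* (suc n) _ (fromℕ (suc n))))
                                                                        (÷ℕ-*-cancel 1 (suc n)) ⟩
  sum1to (suc n) (λ k → ((n C pred k) ÷ℕ k) * fromℕ (suc n)) + 1ℚ
                                                          ≡⟨ cong (_+ 1ℚ) (sum1to-cong (suc n) absorb) ⟩
  sum1to (suc n) (λ k → fromℕ (suc n C k)) + 1ℚ           ≡⟨ QP.+-comm (sum1to (suc n) (λ k → fromℕ (suc n C k))) 1ℚ ⟩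
  1ℚ + sum1to (suc n) (λ k → fromℕ (suc n C k))           ≡⟨ binomial-sum (suc n) ⟩
  fromℕ (2 N.^ suc n)                                     ∎)
  where
  G = sum1to (suc n) (λ k → (n C pred k) ÷ℕ k)
  absorb : ∀ j → ((n C j) ÷ℕ suc j) * fromℕ (suc n) ≡ fromℕ (suc n C suc j)
  absorb j = begin
    ((n C j) ÷ℕ suc j) * fromℕ (suc n)   ≡⟨ ÷ℕ-*-fromℕ (n C j) (suc n) (suc j) ⟩
    ((n C j) N.* suc n) ÷ℕ suc j         ≡⟨ cong (_÷ℕ suc j) (begin
      (n C j) N.* suc n                     ≡⟨ NP.*-comm (n C j) (suc n) ⟩
      suc n N.* (n C j)                     ≡⟨ [1+k]*[1+n]C[1+k]≡[1+n]*nCk n j ⟨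
      suc j N.* (suc n C suc j)             ≡⟨ NP.*-comm (suc j) (suc n C suc j) ⟩
      (suc n C suc j) N.* suc j             ∎) ⟩
    ((suc n C suc j) N.* suc j) ÷ℕ suc j ≡⟨ *÷ℕ-cancel (suc n C suc j) (suc j) ⟩
    fromℕ (suc n C suc j)                ∎

sum-nCk/k : ∀ n → sum1to n (λ k → (n C k) ÷ℕ k) ≡ (- sum1to n (λ k → 1 ÷ℕ k)) + sum1to n (λ k → (2 N.^ k) ÷ℕ k)
sum-nCk/k zero    = refl
sum-nCk/k (suc n) = begin
  sum1to (suc n) (λ k → (suc n C k) ÷ℕ k)                         ≡⟨ sum1to-cong (suc n) pascal ⟩
  sum1to (suc n) (λ k → (n C k) ÷ℕ k + (n C pred k) ÷ℕ k)         ≡⟨ sum1to-distrib-+ (suc n) _ _ ⟩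
  sum1to (suc n) (λ k → (n C k) ÷ℕ k) + G                         ≡⟨ cong (_+ G) (sum1to-extend n _ (nC[1+n]÷ℕd≡0 n (suc n))) ⟩
  sum1to n (λ k → (n C k) ÷ℕ k) + G                               ≡⟨ cong (_+ G) (sum-nCk/k n) ⟩
  (- H + P) + G                                                   ≡⟨ regroup H P G (1 ÷ℕ suc n) ⟩
  - (H + 1 ÷ℕ suc n) + (P + (G + 1 ÷ℕ suc n))                     ≡⟨ cong (λ x → - (H + 1 ÷ℕ suc n) + (P + x)) (sum-nC[k-1]/k n) ⟩
  - (H + 1 ÷ℕ suc n) + (P + (2 N.^ suc n) ÷ℕ suc n)               ∎
  where
  open +-*-Solver
  G = sum1to (suc n) (λ k → (n C pred k) ÷ℕ k)
  H = sum1to n (λ k → 1 ÷ℕ k)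
  P = sum1to n (λ k → (2 N.^ k) ÷ℕ k)
  pascal : ∀ j → (suc n C suc j) ÷ℕ suc j ≡ (n C suc j) ÷ℕ suc j + (n C j) ÷ℕ suc j
  pascal j = trans (cong (_÷ℕ suc j) ([1+n]C[1+k]≡nC[1+k]+nCk n j)) (÷ℕ-distribʳ-+ (n C suc j) (n C j) (suc j))
  regroup : ∀ h p g i → (- h + p) + g ≡ - (h + i) + (p + (g + i))
  regroup = solve 4 (λ h p g i → (:- h :+ p) :+ g := :- (h :+ i) :+ (p :+ (g :+ i))) refl

oddDenominatorSum : ℕ → ℚ
oddDenominatorSum n = sum1to n (λ k → (n C k) ÷ℕ (1 N.+ 2 N.* k))

centralFactor : ℕ → ℚ
centralFactor n = (4 N.^ n) ÷ℕ ((1 N.+ 2 N.* n) N.* ((2 N.* n) C n))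

centralSum : ℕ → ℚ
centralSum n = sum1to n (λ k → ((2 N.* k) C k) ÷ℕ (2 N.^ k))

C[2n,n]≢0 : ∀ n → NonZero ((2 N.* n) C n)
C[2n,n]≢0 n = N.>-nonZero (k≤n⇒nCk>0 (NP.m≤m+n n (n N.+ 0)))

[1+2n]*C[2n,n]≢0 : ∀ n → NonZero ((1 N.+ 2 N.* n) N.* ((2 N.* n) C n))
[1+2n]*C[2n,n]≢0 n = NP.m*n≢0 (1 N.+ 2 N.* n) ((2 N.* n) C n) {{_}} {{C[2n,n]≢0 n}}

centralFactor-*-[1+2n] : ∀ n → centralFactor n * fromℕ (1 N.+ 2 N.* n) ≡ (4 N.^ n) ÷ℕ ((2 N.* n) C n)
centralFactor-*-[1+2n] n = ÷ℕ-unique (4 N.^ n) c (begin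
  centralFactor n * fromℕ (1 N.+ 2 N.* n) * fromℕ c     ≡⟨ QP.*-assoc (centralFactor n) _ (fromℕ c) ⟩
  centralFactor n * (fromℕ (1 N.+ 2 N.* n) * fromℕ c)   ≡⟨ cong (centralFactor n *_) (fromℕ-homo-* (1 N.+ 2 N.* n) c) ⟨
  centralFactor n * fromℕ ((1 N.+ 2 N.* n) N.* c)       ≡⟨ ÷ℕ-*-cancel (4 N.^ n) ((1 N.+ 2 N.* n) N.* c) ⟩
  fromℕ (4 N.^ n)                                       ∎)
  where
  c = (2 N.* n) C n
  instance _ = C[2n,n]≢0 n
           _ = [1+2n]*C[2n,n]≢0 n

centralFactor-rec : ∀ n → centralFactor (suc n) * fromℕ (1 N.+ 2 N.* suc n) ≡ centralFactor n * fromℕ (2 N.* suc n)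
centralFactor-rec n = trans (centralFactor-*-[1+2n] (suc n)) (sym (÷ℕ-unique (4 N.^ suc n) X (begin
  centralFactor n * fromℕ F * fromℕ X      ≡⟨ cong (_* fromℕ X) (÷ℕ-*-fromℕ (4 N.^ n) F D) ⟩
  ((4 N.^ n N.* F) ÷ℕ D) * fromℕ X         ≡⟨ ÷ℕ-*-fromℕ (4 N.^ n N.* F) X D ⟩
  (4 N.^ n N.* F N.* X) ÷ℕ D               ≡⟨ cong (_÷ℕ D) 4^n*F*X≡4^[1+n]*D ⟩
  (4 N.^ suc n N.* D) ÷ℕ D                 ≡⟨ *÷ℕ-cancel (4 N.^ suc n) D ⟩
  fromℕ (4 N.^ suc n)                      ∎)))
  where
  open import Data.Nat.Tactic.RingSolver using (solve-∀)
  F = 2 N.* suc n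
  X = (2 N.* suc n) C suc n
  D = (1 N.+ 2 N.* n) N.* ((2 N.* n) C n)
  instance _ = C[2n,n]≢0 (suc n)
           _ = [1+2n]*C[2n,n]≢0 n
  regroup : ∀ p n x → p N.* (2 N.* suc n) N.* x ≡ p N.* 2 N.* (suc n N.* x)
  regroup = solve-∀
  collect : ∀ p d → p N.* 2 N.* (2 N.* d) ≡ 4 N.* p N.* d
  collect = solve-∀
  4^n*F*X≡4^[1+n]*D : 4 N.^ n N.* F N.* X ≡ 4 N.^ suc n N.* D
  4^n*F*X≡4^[1+n]*D = begin
    4 N.^ n N.* F N.* X                ≡⟨ regroup (4 N.^ n) n X ⟩
    4 N.^ n N.* 2 N.* (suc n N.* X)    ≡⟨ cong (4 N.^ n N.* 2 N.*_) ([1+n]*C[2+2n,1+n]≡2*[1+2n]*C[2n,n] n) ⟩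
    4 N.^ n N.* 2 N.* (2 N.* D)        ≡⟨ collect (4 N.^ n) D ⟩
    4 N.^ suc n N.* D                  ∎

centralFactor-*-centralTerm : ∀ n →
  centralFactor (suc n) * fromℕ (1 N.+ 2 N.* suc n) * (((2 N.* suc n) C suc n) ÷ℕ (2 N.^ suc n)) ≡ fromℕ (2 N.^ suc n)
centralFactor-*-centralTerm n = begin
  centralFactor (suc n) * fromℕ (1 N.+ 2 N.* suc n) * (X ÷ℕ P) ≡⟨ cong (_* (X ÷ℕ P)) (centralFactor-*-[1+2n] (suc n)) ⟩
  ((4 N.^ suc n) ÷ℕ X) * (X ÷ℕ P)                              ≡⟨ ÷ℕ-*-÷ℕ (4 N.^ suc n) X P ⟩
  (4 N.^ suc n) ÷ℕ P                                           ≡⟨ cong (_÷ℕ P) (4^m≡2^m*2^m (suc n)) ⟩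
  (P N.* P) ÷ℕ P                                               ≡⟨ *÷ℕ-cancel P P ⟩
  fromℕ P                                                      ∎
  where
  open import Data.Nat.Tactic.RingSolver using (solve-∀)
  X = (2 N.* suc n) C suc n
  P = 2 N.^ suc n
  instance _ = C[2n,n]≢0 (suc n)
           _ = NP.m^n≢0 2 (suc n)
  square : ∀ x → 4 N.* (x N.* x) ≡ 2 N.* x N.* (2 N.* x)
  square = solve-∀
  4^m≡2^m*2^m : ∀ m → 4 N.^ m ≡ 2 N.^ m N.* 2 N.^ m
  4^m≡2^m*2^m zero    = refl
  4^m≡2^m*2^m (suc m) = trans (cong (4 N.*_) (4^m≡2^m*2^m m)) (square (2 N.^ m))

oddDenominatorSum-scaled : ∀ n →
  oddDenominatorSum (suc n) * fromℕ (1 N.+ 2 N.* suc n)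
    ≡ sum1to (suc n) (λ k → fromℕ (suc n C k)) + oddDenominatorSum n * fromℕ (2 N.* suc n)
oddDenominatorSum-scaled n = begin
  oddDenominatorSum (suc n) * fromℕ E                              ≡⟨ sum1to-distribʳ-* (suc n) _ (fromℕ E) ⟨
  sum1to (suc n) (λ k → ((suc n C k) ÷ℕ d k) * fromℕ E)            ≡⟨ sum1to-cong (suc n) (λ k → split (suc k)) ⟩
  sum1to (suc n) (λ k → fromℕ (suc n C k) + ((n C k) ÷ℕ d k) * fromℕ F)
                                                                   ≡⟨ sum1to-distrib-+ (suc n) _ _ ⟩
  B + sum1to (suc n) (λ k → ((n C k) ÷ℕ d k) * fromℕ F)            ≡⟨ cong (B +_) (sum1to-distribʳ-* (suc n) _ (fromℕ F)) ⟩
  B + sum1to (suc n) (λ k → (n C k) ÷ℕ d k) * fromℕ F              ≡⟨ cong (λ s → B + s * fromℕ F) (sum1to-extend n _ (nC[1+n]÷ℕd≡0 n E)) ⟩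
  B + oddDenominatorSum n * fromℕ F                                ∎
  where
  E = 1 N.+ 2 N.* suc n
  F = 2 N.* suc n
  d = λ k → 1 N.+ 2 N.* k
  B = sum1to (suc n) (λ k → fromℕ (suc n C k))
  split : ∀ k → ((suc n C k) ÷ℕ d k) * fromℕ E ≡ fromℕ (suc n C k) + ((n C k) ÷ℕ d k) * fromℕ F
  split k = begin
    (x ÷ℕ d k) * fromℕ E              ≡⟨ ÷ℕ-*-fromℕ x E (d k) ⟩
    (x N.* E) ÷ℕ d k                  ≡⟨ cong (_÷ℕ d k) ([1+n]Ck*[1+2[1+n]]≡[1+n]Ck*[1+2k]+nCk*2[1+n] n k) ⟩
    (x N.* d k N.+ y N.* F) ÷ℕ d k    ≡⟨ ÷ℕ-distribʳ-+ (x N.* d k) (y N.* F) (d k) ⟩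
    (x N.* d k) ÷ℕ d k + (y N.* F) ÷ℕ d k ≡⟨ cong₂ _+_ (*÷ℕ-cancel x (d k)) (sym (÷ℕ-*-fromℕ y F (d k))) ⟩
    fromℕ x + (y ÷ℕ d k) * fromℕ F    ∎
    where
    x = suc n C k
    y = n C k

oddDenominatorSum-rec : ∀ n →
  (oddDenominatorSum (suc n) + 1ℚ) * fromℕ (1 N.+ 2 N.* suc n)
    ≡ (oddDenominatorSum n + 1ℚ) * fromℕ (2 N.* suc n) + fromℕ (2 N.^ suc n)
oddDenominatorSum-rec n = begin
  (oddDenominatorSum (suc n) + 1ℚ) * fromℕ (1 N.+ F)     ≡⟨ distrib (oddDenominatorSum (suc n)) (fromℕ (1 N.+ F)) ⟩
  oddDenominatorSum (suc n) * fromℕ (1 N.+ F) + fromℕ (1 N.+ F)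
                                                         ≡⟨ cong₂ _+_ (oddDenominatorSum-scaled n) (fromℕ-homo-+ 1 F) ⟩
  (B + oddDenominatorSum n * fromℕ F) + (1ℚ + fromℕ F)   ≡⟨ regroup B (oddDenominatorSum n) (fromℕ F) ⟩
  (oddDenominatorSum n + 1ℚ) * fromℕ F + (1ℚ + B)        ≡⟨ cong ((oddDenominatorSum n + 1ℚ) * fromℕ F +_) (binomial-sum (suc n)) ⟩
  (oddDenominatorSum n + 1ℚ) * fromℕ F + fromℕ (2 N.^ suc n) ∎
  where
  open +-*-Solver
  F = 2 N.* suc n
  B = sum1to (suc n) (λ k → fromℕ (suc n C k))
  distrib : ∀ t e → (t + 1ℚ) * e ≡ t * e + e
  distrib = solve 2 (λ t e → (t :+ con 1ℚ) :* e := t :* e :+ e) refl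
  regroup : ∀ b t f → (b + t * f) + (1ℚ + f) ≡ (t + 1ℚ) * f + (1ℚ + b)
  regroup = solve 3 (λ b t f → (b :+ t :* f) :+ (con 1ℚ :+ f) := (t :+ con 1ℚ) :* f :+ (con 1ℚ :+ b)) refl

oddDenominatorSum+1≡centralFactor*[centralSum+1] : ∀ n →
  oddDenominatorSum n + 1ℚ ≡ centralFactor n * (centralSum n + 1ℚ)
oddDenominatorSum+1≡centralFactor*[centralSum+1] zero    = refl
oddDenominatorSum+1≡centralFactor*[centralSum+1] (suc n) = *-cancelʳ-fromℕ E (begin
  (oddDenominatorSum (suc n) + 1ℚ) * fromℕ E                 ≡⟨ oddDenominatorSum-rec n ⟩
  (oddDenominatorSum n + 1ℚ) * fromℕ F + fromℕ P
    ≡⟨ cong (λ t → t * fromℕ F + fromℕ P) (oddDenominatorSum+1≡centralFactor*[centralSum+1] n) ⟩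
  centralFactor n * (centralSum n + 1ℚ) * fromℕ F + fromℕ P  ≡⟨ commute (centralFactor n) (centralSum n) (fromℕ F) (fromℕ P) ⟩
  centralFactor n * fromℕ F * (centralSum n + 1ℚ) + fromℕ P  ≡⟨ cong₂ (λ a p → a * (centralSum n + 1ℚ) + p)
                                                                     (sym (centralFactor-rec n)) (sym (centralFactor-*-centralTerm n)) ⟩
  a * fromℕ E * (centralSum n + 1ℚ) + a * fromℕ E * v        ≡⟨ collect a (centralSum n) v (fromℕ E) ⟩
  a * (centralSum n + v + 1ℚ) * fromℕ E                      ∎)
  where
  open +-*-Solver
  E = 1 N.+ 2 N.* suc n
  F = 2 N.* suc n
  P = 2 N.^ suc n
  a = centralFactor (suc n)
  v = ((2 N.* suc n) C suc n) ÷ℕ P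
  commute : ∀ a u f p → a * (u + 1ℚ) * f + p ≡ a * f * (u + 1ℚ) + p
  commute = solve 4 (λ a u f p → a :* (u :+ con 1ℚ) :* f :+ p := a :* f :* (u :+ con 1ℚ) :+ p) refl
  collect : ∀ a u v e → a * e * (u + 1ℚ) + a * e * v ≡ a * (u + v + 1ℚ) * e
  collect = solve 4 (λ a u v e → a :* e :* (u :+ con 1ℚ) :+ a :* e :* v := a :* (u :+ v :+ con 1ℚ) :* e) refl

oddDenominatorSum-closedForm : ∀ n → oddDenominatorSum n ≡ centralFactor n * centralSum n + centralFactor n - 1ℚ
oddDenominatorSum-closedForm n = begin
  oddDenominatorSum n                                  ≡⟨ add-sub (oddDenominatorSum n) ⟩
  oddDenominatorSum n + 1ℚ - 1ℚ                        ≡⟨ cong (_- 1ℚ) (oddDenominatorSum+1≡centralFactor*[centralSum+1] n) ⟩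
  centralFactor n * (centralSum n + 1ℚ) - 1ℚ           ≡⟨ expand (centralFactor n) (centralSum n) ⟩
  centralFactor n * centralSum n + centralFactor n - 1ℚ ∎
  where
  open +-*-Solver
  add-sub : ∀ t → t ≡ t + 1ℚ - 1ℚ
  add-sub = solve 1 (λ t → t := t :+ con 1ℚ :- con 1ℚ) refl
  expand : ∀ a u → a * (u + 1ℚ) - 1ℚ ≡ a * u + a - 1ℚ
  expand = solve 2 (λ a u → a :* (u :+ con 1ℚ) :- con 1ℚ := a :* u :+ a :- con 1ℚ) refl

lemma2p3 : (n : ℕ) → 1 ≤ n →
    (sum1to n (λ k → (n C k) ÷ℕ (1 N.+ 2 N.* k))
      ≡ ((4 N.^ n) ÷ℕ ((1 N.+ 2 N.* n) N.* ((2 N.* n) C n))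
           * sum1to n (λ k → ((2 N.* k) C k) ÷ℕ (2 N.^ k)))
        + (4 N.^ n) ÷ℕ ((1 N.+ 2 N.* n) N.* ((2 N.* n) C n))
        - 1ℚ)
    × (sum1to n (λ k → (n C k) ÷ℕ k)
      ≡ (- sum1to n (λ k → 1 ÷ℕ k)) + sum1to n (λ k → (2 N.^ k) ÷ℕ k))
-- Both identities also hold for n = 0.
lemma2p3 n _ = oddDenominatorSum-closedForm n , sum-nCk/k n
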